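{- Let $r\ge 3$ and $t\ge 2$ be integers and let $F$ be a graph. Then for all $n$: (i) $ex(n,\mathbb{B}_tF)\le ex(n,\mathbb{B}_{t-1}F)+\binom{n}{2}$, and (ii) $ex_r(n,\mathbb{B}^r_tF)\le ex_r(n,\mathbb{B}^r_{t-1}F)+\binom{n}{2}$.
   Context: A hypergraph consists of a finite vertex set and a set of distinct subsets of it (hyperedges); it is $r$-uniform if all hyperedges have size $r$. For an integer $t\ge1$ and a graph $F$, a hypergraph $\mathcal{F}$ is a $t$-wise Berge copy of $F$ if $|E(\mathcal{F})|=t|E(F)|$ and there exist an injection $i:V(F)\to V(\mathcal{F})$ and a map $h$ assigning to each edge $e$ of $F$ a set $h(e)$ of $t$ hyperedges of $\mathcal{F}$ such that $h(e)\cap h(e')=\emptyset$ for distinct edges $e,e'$, and for every edge $e=xy$ of $F$, $\{i(x),i(y)\}\subseteq A$ for all $A\in h(e)$. $\mathbb{B}_tF$ is the family of all $t$-wise Berge copies of $F$ (not necessarily uniform), and $\mathbb{B}_t^rF$ the family of $r$-uniform ones. $ex(n,\mathbb{F})$ is the maximum number of hyperedges in a hypergraph on $n$ vertices containing no member of $\mathbb{F}$ as a subhypergraph, and $ex_r(n,\mathbb{F})$ is the same maximum over $r$-uniform hypergraphs. -}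

module Defs where

open import Data.Nat using (ℕ; _<_; _≤_)
open import Data.Fin using (Fin; toℕ)
open import Data.Fin.Subset using (Subset; _∈_; ∣_∣)
open import Data.List using (List; length; lookup)
open import Data.List.Relation.Unary.All using (All)
open import Data.List.Relation.Unary.Unique.Propositional using (Unique)
open import Data.Product using (Σ; _×_; proj₁; proj₂)
open import Relation.Binary.PropositionalEquality using (_≡_)
open import Relation.Nullary using (¬_)

-- A finite simple graph F on vertex set Fin k.  Each edge {x,y} is stored
-- once, as an ordered pair with x < y; edges are pairwise distinct.
record Graph : Set where
  field
    k      : ℕ
    edges  : List (Fin k × Fin k)
    sorted : All (λ e → toℕ (proj₁ e) < toℕ (proj₂ e)) edges
    unique : Unique edges

record Hypergraph (n : ℕ) : Set where
  field
    hedges : List (Subset n)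
    unique : Unique hedges

open Graph
open Hypergraph

size : ∀ {n} → Hypergraph n → ℕ
size H = length (hedges H)

Uniform : ∀ {n} → ℕ → Hypergraph n → Set
Uniform r H = All (λ A → ∣ A ∣ ≡ r) (hedges H)

ContainsBerge : ∀ {n} → ℕ → Graph → Hypergraph n → Set
ContainsBerge {n} t F H =
  Σ (Fin (k F) → Fin n) λ i →
  (∀ x y → i x ≡ i y → x ≡ y) ×
  Σ (Fin (length (edges F)) → Fin t → Fin (size H)) λ h →
  (∀ e j e′ j′ → h e j ≡ h e′ j′ → (e ≡ e′ × j ≡ j′)) ×
  (∀ e j → (i (proj₁ (lookup (edges F) e)) ∈ lookup (hedges H) (h e j))
         × (i (proj₂ (lookup (edges F) e)) ∈ lookup (hedges H) (h e j)))

IsMax : (n : ℕ) → (Hypergraph n → Set) → ℕ → Set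
IsMax n P m = Σ (Hypergraph n) (λ H → P H × size H ≡ m)
            × (∀ H → P H → size H ≤ m)

IsEx : ℕ → ℕ → Graph → ℕ → Set
IsEx n t F m = IsMax n (λ H → ¬ ContainsBerge t F H) m

IsExUnif : ℕ → ℕ → ℕ → Graph → ℕ → Set
IsExUnif r n t F m = IsMax n (λ H → Uniform r H × ¬ ContainsBerge t F H) m

-- Greedily delete, for every pair {u, v} of vertices that lies in some hyperedge, one
-- hyperedge containing it, choosing a different hyperedge for each pair.  At most
-- n C 2 hyperedges go, and every pair still covered by a surviving hyperedge owns a
-- deleted hyperedge.  A (t-1)-wise Berge copy of F among the survivors therefore
-- extends to a t-wise copy in the original hypergraph: each edge xy of F additionally
-- receives the deleted hyperedge owned by {i x, i y}.  Deletion preserves uniformity,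
-- so the same bound holds in the r-uniform setting.
module Submission where

open import Defs
open import Data.Nat using (ℕ; suc; _≤_; _<_; _+_; _∸_; s≤s)
open import Data.Nat.Properties
  using (≤-trans; ≤-reflexive; +-suc; +-identityʳ; +-monoˡ-≤; +-monoʳ-≤; n≤1+n; <-cmp; <-irrefl; <-asym; module ≤-Reasoning)
open import Data.Nat.Combinatorics using (_C_; nC1≡n; nCk+nC[k+1]≡[n+1]C[k+1])
open import Data.Fin using (Fin; toℕ)
open import Data.Fin.Properties using (toℕ-injective)
open import Data.Fin.Subset using (Subset) renaming (_∈_ to _∈ₛ_)
open import Data.Fin.Subset.Properties using (_∈?_)
open import Data.List using (List; []; _∷_; length; lookup; map; _++_; allFin; removeAt)
open import Data.List.Properties using (length-++; length-map; length-tabulate; length-removeAt′)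
import Data.List.Relation.Unary.All as All
open import Data.List.Relation.Unary.Any as Any using (Any; here; there; any?)
open import Data.List.Relation.Unary.Any.Properties using (lookup-index)
open import Data.List.Relation.Unary.AllPairs using ([]; _∷_)
open import Data.List.Relation.Unary.Unique.Propositional using (Unique)
open import Data.List.Relation.Binary.Sublist.Propositional
  using (_⊆_; []; _∷_; _∷ʳ_; ⊆-refl; ⊆-trans) renaming (lookup to ⊆-lookup)
open import Data.List.Relation.Binary.Sublist.Propositional.Properties using (All-resp-⊆)
open import Data.List.Membership.Propositional using (_∈_; _∉_; lose)
open import Data.List.Membership.Propositional.Properties using (∈-lookup; ∈-allFin; ∈-map⁺; ∈-++⁺ˡ; ∈-++⁺ʳ)
open import Data.Product using (Σ; _×_; ∃; _,_; proj₁; proj₂; swap)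
open import Data.Sum using (_⊎_; inj₁; inj₂)
open import Data.Empty using (⊥-elim)
open import Function using (_∘_)
open import Relation.Nullary using (¬_; Dec; yes; no)
open import Relation.Nullary.Decidable using (_×-dec_)
open import Relation.Binary using (tri<; tri≈; tri>)
open import Relation.Binary.PropositionalEquality using (_≡_; refl; sym; trans; cong; cong₂; subst; _≢_; module ≡-Reasoning)

open Graph
open Hypergraph

module _ {A : Set} where

  Unique-resp-⊇ : {xs ys : List A} → ys ⊆ xs → Unique xs → Unique ys
  Unique-resp-⊇ []       []         = []
  Unique-resp-⊇ (_ ∷ʳ τ) (_ ∷ u)    = Unique-resp-⊇ τ u
  Unique-resp-⊇ (refl ∷ τ) (x∉ ∷ u) = All-resp-⊆ τ x∉ ∷ Unique-resp-⊇ τ u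

  Unique⇒lookup-injective : {xs : List A} → Unique xs → ∀ i j → lookup xs i ≡ lookup xs j → i ≡ j
  Unique⇒lookup-injective (_ ∷ _)  Fin.zero    Fin.zero    _  = refl
  Unique⇒lookup-injective (x∉ ∷ _) Fin.zero    (Fin.suc j) eq = ⊥-elim (All.lookup x∉ (∈-lookup j) eq)
  Unique⇒lookup-injective (x∉ ∷ _) (Fin.suc i) Fin.zero    eq = ⊥-elim (All.lookup x∉ (∈-lookup i) (sym eq))
  Unique⇒lookup-injective (_ ∷ u)  (Fin.suc i) (Fin.suc j) eq = cong Fin.suc (Unique⇒lookup-injective u i j eq)

  removeAt⊆ : (xs : List A) (i : Fin (length xs)) → removeAt xs i ⊆ xs
  removeAt⊆ (x ∷ xs) Fin.zero    = x ∷ʳ ⊆-refl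
  removeAt⊆ (x ∷ xs) (Fin.suc i) = refl ∷ removeAt⊆ xs i

  Unique⇒lookup∉removeAt : {xs : List A} → Unique xs → ∀ i → lookup xs i ∉ removeAt xs i
  Unique⇒lookup∉removeAt (x∉ ∷ _) Fin.zero    m         = All.lookup x∉ m refl
  Unique⇒lookup∉removeAt (x∉ ∷ _) (Fin.suc i) (here eq) = All.lookup x∉ (∈-lookup i) (sym eq)
  Unique⇒lookup∉removeAt (_ ∷ u)  (Fin.suc i) (there m) = Unique⇒lookup∉removeAt u i m

mapBoth : {A B : Set} → (A → B) → A × A → B × B
mapBoth f p = f (proj₁ p) , f (proj₂ p)

SameEnds : {A : Set} → A × A → A × A → Set
SameEnds p q = p ≡ q ⊎ p ≡ swap q

module _ {A : Set} where

  SameEnds-sym : {p q : A × A} → SameEnds p q → SameEnds q p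
  SameEnds-sym (inj₁ refl) = inj₁ refl
  SameEnds-sym (inj₂ refl) = inj₂ refl

  SameEnds-trans : {p q r : A × A} → SameEnds p q → SameEnds q r → SameEnds p r
  SameEnds-trans (inj₁ refl) qr          = qr
  SameEnds-trans (inj₂ refl) (inj₁ refl) = inj₂ refl
  SameEnds-trans (inj₂ refl) (inj₂ refl) = inj₁ refl

  SameEnds-map⁻ : {B : Set} {f : A → B} → (∀ {x y} → f x ≡ f y → x ≡ y) → {p q : A × A} →
                  SameEnds (mapBoth f p) (mapBoth f q) → SameEnds p q
  SameEnds-map⁻ f-inj (inj₁ eq) = inj₁ (cong₂ _,_ (f-inj (cong proj₁ eq)) (f-inj (cong proj₂ eq)))
  SameEnds-map⁻ f-inj (inj₂ eq) = inj₂ (cong₂ _,_ (f-inj (cong proj₁ eq)) (f-inj (cong proj₂ eq)))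

increasingPairs : ∀ n → List (Fin n × Fin n)
increasingPairs 0       = []
increasingPairs (suc n) = map (λ v → Fin.zero , Fin.suc v) (allFin n)
                       ++ map (mapBoth Fin.suc) (increasingPairs n)

length-increasingPairs : ∀ n → length (increasingPairs n) ≡ n C 2
length-increasingPairs 0       = refl
length-increasingPairs (suc n) = begin
  length (increasingPairs (suc n))
    ≡⟨ length-++ (map _ (allFin n)) ⟩
  length (map _ (allFin n)) + length (map _ (increasingPairs n))
    ≡⟨ cong₂ _+_ (trans (length-map _ (allFin n)) (length-tabulate _))
                 (trans (length-map _ (increasingPairs n)) (length-increasingPairs n)) ⟩
  n + n C 2
    ≡⟨ cong (_+ n C 2) (sym (nC1≡n n)) ⟩
  n C 1 + n C 2
    ≡⟨ nCk+nC[k+1]≡[n+1]C[k+1] n 1 ⟩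
  suc n C 2
    ∎
  where open ≡-Reasoning

∈-increasingPairs : ∀ {n} {u v : Fin n} → toℕ u < toℕ v → (u , v) ∈ increasingPairs n
∈-increasingPairs {suc n} {Fin.zero}  {Fin.suc v} _       = ∈-++⁺ˡ (∈-map⁺ _ (∈-allFin v))
∈-increasingPairs {suc n} {Fin.suc u} {Fin.suc v} (s≤s lt) = ∈-++⁺ʳ (map _ (allFin n)) (∈-map⁺ _ (∈-increasingPairs lt))

increasingPairs-complete : ∀ {n} {u v : Fin n} → u ≢ v → ∃ λ p → p ∈ increasingPairs n × SameEnds p (u , v)
increasingPairs-complete {u = u} {v} u≢v with <-cmp (toℕ u) (toℕ v)
... | tri< u<v _ _ = _ , ∈-increasingPairs u<v , inj₁ refl
... | tri≈ _ u≡v _ = ⊥-elim (u≢v (toℕ-injective u≡v))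
... | tri> _ _ v<u = _ , ∈-increasingPairs v<u , inj₂ refl

module _ {n : ℕ} where

  Covers : Subset n → Fin n × Fin n → Set
  Covers A p = proj₁ p ∈ₛ A × proj₂ p ∈ₛ A

  Covers? : ∀ A p → Dec (Covers A p)
  Covers? A p = (proj₁ p ∈? A) ×-dec (proj₂ p ∈? A)

  Covers-resp-SameEnds : ∀ {A p q} → SameEnds p q → Covers A p → Covers A q
  Covers-resp-SameEnds (inj₁ refl) c = c
  Covers-resp-SameEnds (inj₂ refl) c = swap c

module _ (F : Graph) where

  ends : Fin (length (edges F)) → Fin (k F) × Fin (k F)
  ends = lookup (edges F)

  ends-sorted : ∀ e → toℕ (proj₁ (ends e)) < toℕ (proj₂ (ends e))
  ends-sorted e = All.lookup (sorted F) (∈-lookup e)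

  ends-distinct : ∀ e → proj₁ (ends e) ≢ proj₂ (ends e)
  ends-distinct e eq = <-irrefl (cong toℕ eq) (ends-sorted e)

  SameEnds-ends⇒≡ : ∀ {e e′} → SameEnds (ends e) (ends e′) → e ≡ e′
  SameEnds-ends⇒≡ (inj₁ eq) = Unique⇒lookup-injective (unique F) _ _ eq
  SameEnds-ends⇒≡ {e} {e′} (inj₂ eq) =
    ⊥-elim (<-asym (ends-sorted e′) (subst (λ p → toℕ (proj₁ p) < toℕ (proj₂ p)) eq (ends-sorted e)))

record Thinning {A P : Set} (R : A → P → Set) (Ps : List P) (K : List A) : Set where
  field
    kept            : List A
    kept⊆           : kept ⊆ K
    length-≤        : length K ≤ length kept + length Ps
    owner           : ∀ {p} → p ∈ Ps → Any (λ a → R a p) kept → Σ A λ a → a ∈ K × a ∉ kept × R a p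
    owner-injective : ∀ {p q} (p∈ : p ∈ Ps) (q∈ : q ∈ Ps) c d →
                      proj₁ (owner p∈ c) ≡ proj₁ (owner q∈ d) → p ≡ q

module _ {A P : Set} {R : A → P → Set} where

  open Thinning

  thinning-[] : ∀ K → Thinning R [] K
  thinning-[] K = record
    { kept = K ; kept⊆ = ⊆-refl ; length-≤ = ≤-reflexive (sym (+-identityʳ (length K)))
    ; owner = λ () ; owner-injective = λ () }

  thinning-uncovered : ∀ {p Ps K} → ¬ Any (λ a → R a p) K → Thinning R Ps K → Thinning R (p ∷ Ps) K
  thinning-uncovered {p} {Ps} {K} ¬c T = record
    { kept = kept T ; kept⊆ = kept⊆ T
    ; length-≤ = ≤-trans (length-≤ T) (+-monoʳ-≤ (length (kept T)) (n≤1+n (length Ps)))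
    ; owner = own ; owner-injective = own-inj }
    where
    own : ∀ {q} → q ∈ p ∷ Ps → Any (λ a → R a q) (kept T) → Σ A λ a → a ∈ K × a ∉ kept T × R a q
    own (here refl) c = ⊥-elim (¬c (⊆-lookup (kept⊆ T) c))
    own (there q∈) c  = owner T q∈ c
    own-inj : ∀ {q q′} (q∈ : q ∈ p ∷ Ps) (q′∈ : q′ ∈ p ∷ Ps) c d → proj₁ (own q∈ c) ≡ proj₁ (own q′∈ d) → q ≡ q′
    own-inj (here refl) _ c _ _ = ⊥-elim (¬c (⊆-lookup (kept⊆ T) c))
    own-inj (there _) (here refl) _ d _ = ⊥-elim (¬c (⊆-lookup (kept⊆ T) d))
    own-inj (there q∈) (there q′∈) = owner-injective T q∈ q′∈

  thinning-covered : ∀ {p Ps K} → Unique K → (c : Any (λ a → R a p) K) →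
                     Thinning R Ps (removeAt K (Any.index c)) → Thinning R (p ∷ Ps) K
  thinning-covered {p} {Ps} {K} u c T = record
    { kept = kept T ; kept⊆ = ⊆-trans (kept⊆ T) removed⊆
    ; length-≤ = begin
        length K                            ≡⟨ length-removeAt′ K i ⟩
        suc (length (removeAt K i))         ≤⟨ s≤s (length-≤ T) ⟩
        suc (length (kept T) + length Ps)   ≡⟨ +-suc (length (kept T)) (length Ps) ⟨
        length (kept T) + length (p ∷ Ps)   ∎
    ; owner = own ; owner-injective = own-inj }
    where
    open ≤-Reasoning
    i = Any.index c
    removed⊆ = removeAt⊆ K i
    removed∉ : lookup K i ∉ removeAt K i
    removed∉ = Unique⇒lookup∉removeAt u i
    own : ∀ {q} → q ∈ p ∷ Ps → Any (λ a → R a q) (kept T) → Σ A λ a → a ∈ K × a ∉ kept T × R a q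
    own (here refl) _ = lookup K i , ∈-lookup i , removed∉ ∘ ⊆-lookup (kept⊆ T) , lookup-index c
    own (there q∈) d with owner T q∈ d
    ... | a , a∈ , a∉ , r = a , ⊆-lookup removed⊆ a∈ , a∉ , r
    owned-∈ : ∀ {q} (q∈ : q ∈ Ps) d → proj₁ (owner T q∈ d) ∈ removeAt K i
    owned-∈ q∈ d = proj₁ (proj₂ (owner T q∈ d))
    own-inj : ∀ {q q′} (q∈ : q ∈ p ∷ Ps) (q′∈ : q′ ∈ p ∷ Ps) c d → proj₁ (own q∈ c) ≡ proj₁ (own q′∈ d) → q ≡ q′
    own-inj (here refl) (here refl) _ _ _  = refl
    own-inj (here refl) (there q′∈) _ d eq = ⊥-elim (removed∉ (subst (_∈ removeAt K i) (sym eq) (owned-∈ q′∈ d)))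
    own-inj (there q∈)  (here refl) c _ eq = ⊥-elim (removed∉ (subst (_∈ removeAt K i) eq (owned-∈ q∈ c)))
    own-inj (there q∈)  (there q′∈) c d eq = owner-injective T q∈ q′∈ c d eq

thinning : {A P : Set} {R : A → P → Set} → (∀ a p → Dec (R a p)) → ∀ Ps K → Unique K → Thinning R Ps K
thinning R? []       K _ = thinning-[] K
thinning R? (p ∷ Ps) K u with any? (λ a → R? a p) K
... | yes c = thinning-covered u c (thinning R? Ps _ (Unique-resp-⊇ (removeAt⊆ K (Any.index c)) u))
... | no ¬c = thinning-uncovered ¬c (thinning R? Ps K u)

-- ContainsBerge with the chosen hyperedges themselves in place of their positions in the list.
record BergeCopy {n : ℕ} (t : ℕ) (F : Graph) (K : List (Subset n)) : Set where
  field
    embed           : Fin (k F) → Fin n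
    embed-injective : ∀ {x y} → embed x ≡ embed y → x ≡ y
    host            : Fin (length (edges F)) → Fin t → Subset n
    host-injective  : ∀ {e j e′ j′} → host e j ≡ host e′ j′ → e ≡ e′ × j ≡ j′
    host∈           : ∀ e j → host e j ∈ K
    host-covers     : ∀ e j → Covers (host e j) (mapBoth embed (ends F e))

module _ {n t : ℕ} {F : Graph} (H : Hypergraph n) where

  ContainsBerge⇒BergeCopy : ContainsBerge t F H → BergeCopy t F (hedges H)
  ContainsBerge⇒BergeCopy (i , i-inj , h , h-inj , h-covers) = record
    { embed = i ; embed-injective = i-inj _ _
    ; host = λ e j → lookup (hedges H) (h e j)
    ; host-injective = λ eq → h-inj _ _ _ _ (Unique⇒lookup-injective (unique H) _ _ eq)
    ; host∈ = λ e j → ∈-lookup (h e j)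
    ; host-covers = h-covers }

  BergeCopy⇒ContainsBerge : BergeCopy t F (hedges H) → ContainsBerge t F H
  BergeCopy⇒ContainsBerge C = embed , (λ _ _ → embed-injective) , index , index-injective , index-covers
    where
    open BergeCopy C
    index : Fin (length (edges F)) → Fin t → Fin (size H)
    index e j = Any.index (host∈ e j)
    host≡ : ∀ e j → host e j ≡ lookup (hedges H) (index e j)
    host≡ e j = lookup-index (host∈ e j)
    index-injective : ∀ e j e′ j′ → index e j ≡ index e′ j′ → e ≡ e′ × j ≡ j′
    index-injective e j e′ j′ eq = host-injective (trans (host≡ e j) (trans (cong (lookup (hedges H)) eq) (sym (host≡ e′ j′))))
    index-covers : ∀ e j → Covers (lookup (hedges H) (index e j)) (mapBoth embed (ends F e))
    index-covers e j = subst (λ A → Covers A (mapBoth embed (ends F e))) (host≡ e j) (host-covers e j)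

module _ {n : ℕ} (H : Hypergraph n) where

  pairThinning : Thinning Covers (increasingPairs n) (hedges H)
  pairThinning = thinning Covers? (increasingPairs n) (hedges H) (unique H)

  open Thinning pairThinning

  thin : Hypergraph n
  thin = record { hedges = kept ; unique = Unique-resp-⊇ kept⊆ (unique H) }

  size-≤-thin : size H ≤ size thin + n C 2
  size-≤-thin = ≤-trans length-≤ (≤-reflexive (cong (size thin +_) (length-increasingPairs n)))

  Uniform-thin : ∀ {r} → Uniform r H → Uniform r thin
  Uniform-thin = All-resp-⊆ kept⊆

  BergeCopy-thin : ∀ {s F} → BergeCopy (suc s) F (hedges thin) → BergeCopy (suc (suc s)) F (hedges H)
  BergeCopy-thin {s} {F} C = record
    { embed = embed ; embed-injective = embed-injective
    ; host = host′ ; host-injective = host′-injective ; host∈ = host′∈ ; host-covers = host′-covers }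
    where
    open BergeCopy C
    key : ∀ e → ∃ λ p → p ∈ increasingPairs n × SameEnds p (mapBoth embed (ends F e))
    key e = increasingPairs-complete (ends-distinct F e ∘ embed-injective)
    pair : Fin (length (edges F)) → Fin n × Fin n
    pair e = proj₁ (key e)
    pair-ends : ∀ e → SameEnds (pair e) (mapBoth embed (ends F e))
    pair-ends e = proj₂ (proj₂ (key e))
    pair-injective : ∀ {e e′} → pair e ≡ pair e′ → e ≡ e′
    pair-injective {e} {e′} eq = SameEnds-ends⇒≡ F (SameEnds-map⁻ embed-injective
      (SameEnds-trans (SameEnds-sym (pair-ends e)) (subst (λ p → SameEnds p _) (sym eq) (pair-ends e′))))
    covered : ∀ e → Any (λ a → Covers a (pair e)) kept
    covered e = lose (host∈ e Fin.zero) (Covers-resp-SameEnds (SameEnds-sym (pair-ends e)) (host-covers e Fin.zero))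
    owned : ∀ e → Σ (Subset n) λ a → a ∈ hedges H × a ∉ kept × Covers a (pair e)
    owned e = owner (proj₁ (proj₂ (key e))) (covered e)
    deleted∉kept : ∀ e → proj₁ (owned e) ∉ kept
    deleted∉kept e = proj₁ (proj₂ (proj₂ (owned e)))
    host′ : Fin (length (edges F)) → Fin (suc (suc s)) → Subset n
    host′ e Fin.zero    = proj₁ (owned e)
    host′ e (Fin.suc j) = host e j
    host′∈ : ∀ e j → host′ e j ∈ hedges H
    host′∈ e Fin.zero    = proj₁ (proj₂ (owned e))
    host′∈ e (Fin.suc j) = ⊆-lookup kept⊆ (host∈ e j)
    host′-covers : ∀ e j → Covers (host′ e j) (mapBoth embed (ends F e))
    host′-covers e Fin.zero    = Covers-resp-SameEnds (pair-ends e) (proj₂ (proj₂ (proj₂ (owned e))))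
    host′-covers e (Fin.suc j) = host-covers e j
    host′-injective : ∀ {e j e′ j′} → host′ e j ≡ host′ e′ j′ → e ≡ e′ × j ≡ j′
    host′-injective {e} {Fin.zero}  {e′} {Fin.zero}    eq = pair-injective (owner-injective _ _ (covered e) (covered e′) eq) , refl
    host′-injective {e} {Fin.zero}  {e′} {Fin.suc j′}  eq = ⊥-elim (deleted∉kept e (subst (_∈ kept) (sym eq) (host∈ e′ j′)))
    host′-injective {e} {Fin.suc j} {e′} {Fin.zero}    eq = ⊥-elim (deleted∉kept e′ (subst (_∈ kept) eq (host∈ e j)))
    host′-injective {j = Fin.suc _} {j′ = Fin.suc _} eq with host-injective eq
    ... | refl , refl = refl , refl

  ContainsBerge-thin : ∀ {s F} → ContainsBerge (suc s) F thin → ContainsBerge (suc (suc s)) F H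
  ContainsBerge-thin {s} {F} = BergeCopy⇒ContainsBerge H ∘ BergeCopy-thin {s} {F} ∘ ContainsBerge⇒BergeCopy thin

IsMax-≤ : ∀ {n P Q a b c} → IsMax n P a → IsMax n Q b →
          (∀ H → P H → Σ (Hypergraph n) λ H′ → Q H′ × size H ≤ size H′ + c) → a ≤ b + c
IsMax-≤ {c = c} ((H , PH , refl) , _) (_ , Q-max) reduce with reduce H PH
... | H′ , QH′ , size-≤ = ≤-trans size-≤ (+-monoˡ-≤ c (Q-max H′ QH′))

-- The uniform bound holds for every r.
proposition3 : (r t : ℕ) → 3 ≤ r → 2 ≤ t → (F : Graph) → (n : ℕ) →
    ((a b : ℕ) → IsEx n t F a → IsEx n (t ∸ 1) F b → a ≤ b + n C 2)
    × ((a b : ℕ) → IsExUnif r n t F a → IsExUnif r n (t ∸ 1) F b → a ≤ b + n C 2)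
proposition3 r (suc (suc s)) _ (s≤s (s≤s _)) F n =
    (λ _ _ exₜ exₜ₋₁ → IsMax-≤ exₜ exₜ₋₁ λ H free →
       thin H , free ∘ ContainsBerge-thin H {F = F} , size-≤-thin H)
  , (λ _ _ exₜ exₜ₋₁ → IsMax-≤ exₜ exₜ₋₁ λ H (uniform , free) →
       thin H , (Uniform-thin H uniform , free ∘ ContainsBerge-thin H {F = F}) , size-≤-thin H)
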